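{- Let $p$ be an odd prime and $t\in\mathbb{F}_p^{\times}$. A triple $(Q_1,Q_2,Q_3)\in\tilde{E}_t(\mathbb{F}_p)^3$ corresponds to a quadruple $\{a,b,c,d\}$ whose elements are not pairwise distinct if and only if either there are two nonsingular points $Q_i,Q_j$ with $i\neq j$ such that $Q_i=\pm Q_j+kR$ for some $k\in\{0,1,2,3\}$, or at least two of the points $Q_1,Q_2,Q_3$ are singular.
   Context: For $t\in\mathbb{F}_p$ let $\mathcal{D}_t:(x^2-1)(y^2-1)=t$ and $E_t: V^2=U^3-2(t-2)U^2+t^2U$, with $R=(t,2t)$ and $\mathcal{O}$ the point at infinity; for $t\neq0,1$, $E_t$ is an elliptic curve and $R$ has order $4$; for $t=1$, $E_1:V^2=U(U+1)^2$ has the singular point $(-1,0)$ and the group law is that of its nonsingular points. The map $U=2(x^2-1)y+2x^2-(2-t)$, $V=2Ux$ gives a bijection between the affine $\mathbb{F}_p$-points of $\mathcal{D}_t$ and $\tilde{E}_t(\mathbb{F}_p):=E_t(\mathbb{F}_p)\setminus\{\mathcal{O},R,2R,3R\}$ (for $t=1$ the singular point $(-1,0)$ corresponds to $(0,0)$). To a triple $(Q_1,Q_2,Q_3)$ corresponding to $(t_{12},t_{34}),(t_{13},t_{24}),(t_{14},t_{23})$ on $\mathcal{D}_t$ one associates the quadruple $\{a,b,c,d\}$ (determined up to a common sign) with $a\in\overline{\mathbb{F}_p}$ a square root of $(t_{12}^2-1)(t_{13}^2-1)/(t_{23}^2-1)$ and $b,c,d$ defined by $ab+1=t_{12}^2$,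 $ac+1=t_{13}^2$, $ad+1=t_{14}^2$; then $bc+1=t_{23}^2$, $bd+1=t_{24}^2$, $cd+1=t_{34}^2$, $abcd=t$. -}

module Defs where

open import Data.Nat using (ℕ; zero; suc; NonZero; _∸_) renaming (_+_ to _+ℕ_; _*_ to _*ℕ_; _^_ to _^ℕ_)
open import Data.Nat.DivMod using (_mod_)
open import Data.Fin using (Fin; toℕ) renaming (zero to f0; suc to fs)
open import Data.Fin.Properties using () renaming (_≟_ to _≟Fin_)
open import Data.Product using (_×_; _,_; proj₁; proj₂; ∃; ∃-syntax; Σ-syntax)
open import Data.Sum using (_⊎_)
open import Data.Empty using (⊥)
open import Data.Unit using (⊤)
open import Relation.Nullary using (¬_; yes; no)
open import Relation.Binary.PropositionalEquality using (_≡_; _≢_)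

-- The prime field F_p, modelled as Fin p with arithmetic mod p.
-- (Primality/oddness of p is a hypothesis of the theorem.)

module _ (p : ℕ) .{{_ : NonZero p}} where

  F : Set
  F = Fin p

  fromN : ℕ → F
  fromN n = n mod p

  infixl 6 _+F_ _-F_
  infixl 7 _*F_ _/F_

  _+F_ : F → F → F
  x +F y = (toℕ x +ℕ toℕ y) mod p

  _*F_ : F → F → F
  x *F y = (toℕ x *ℕ toℕ y) mod p

  negF : F → F
  negF x = (p ∸ toℕ x) mod p

  _-F_ : F → F → F
  x -F y = x +F negF y

  -- multiplicative inverse x^(p-2) (Fermat; p prime), with inv 0 = 0
  invF : F → F
  invF x = (toℕ x ^ℕ (p ∸ 2)) mod p

  _/F_ : F → F → F
  x /F y = x *F invF y

  sqF : F → F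
  sqF x = x *F x

  OnD : F → F → F → Set
  OnD t x y = (sqF x -F fromN 1) *F (sqF y -F fromN 1) ≡ t

  a2 : F → F
  a2 t = negF (fromN 2 *F (t -F fromN 2))

  a4 : F → F
  a4 t = sqF t

  data Pt : Set where
    O   : Pt
    aff : F → F → Pt

  OnE : F → Pt → Set
  OnE t O = ⊤
  OnE t (aff U V) = sqF V ≡ U *F sqF U +F a2 t *F sqF U +F a4 t *F U

  -- A point of E_t is singular iff both partial derivatives of
  -- V^2 - (U^3 + a2 U^2 + a4 U) vanish there.
  Singular : F → Pt → Set
  Singular t O = ⊥
  Singular t (aff U V) =
    (fromN 2 *F V ≡ fromN 0) ×
    (fromN 3 *F sqF U +F fromN 2 *F a2 t *F U +F a4 t ≡ fromN 0)

  Nonsingular : F → Pt → Set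
  Nonsingular t Q = OnE t Q × ¬ Singular t Q

  negPt : Pt → Pt
  negPt O = O
  negPt (aff U V) = aff U (negF V)

  addPt : F → Pt → Pt → Pt
  addPt t O Q = Q
  addPt t P O = P
  addPt t (aff x1 y1) (aff x2 y2) with x1 ≟Fin x2
  ... | no _ = third ((y2 -F y1) /F (x2 -F x1))
    where
    third : F → Pt
    third λ' = let x3 = sqF λ' -F a2 t -F x1 -F x2
               in aff x3 (negF (y1 +F λ' *F (x3 -F x1)))
  ... | yes _ with y1 ≟Fin negF y2
  ...   | yes _ = O
  ...   | no _ = third ((fromN 3 *F sqF x1 +F fromN 2 *F a2 t *F x1 +F a4 t)
                        /F (fromN 2 *F y1))
    where
    third : F → Pt
    third λ' = let x3 = sqF λ' -F a2 t -F x1 -F x2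
               in aff x3 (negF (y1 +F λ' *F (x3 -F x1)))

  Rpt : F → Pt
  Rpt t = aff t (fromN 2 *F t)

  mulR : F → ℕ → Pt
  mulR t zero = O
  mulR t (suc k) = addPt t (Rpt t) (mulR t k)

  InẼ : F → Pt → Set
  InẼ t Q = OnE t Q × Q ≢ O × Q ≢ mulR t 1 × Q ≢ mulR t 2 × Q ≢ mulR t 3

  φ : F → F → F → Pt
  φ t x y = let U = fromN 2 *F (sqF x -F fromN 1) *F y +F fromN 2 *F sqF x -F (fromN 2 -F t)
            in aff U (fromN 2 *F U *F x)

  -- The quadruple {a,b,c,d}.  a is a square root in F̄_p of
  --   A = (t12^2-1)(t13^2-1)/(t23^2-1) ;
  -- we work in the F_p-algebra F_p[s]/(s^2 - A) (elements u + v s as pairs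
  -- (u , v)) with a = s, which contains F_p(a) ⊆ F̄_p when A is a nonsquare
  -- (and in which equalities among a,b,c,d ∈ F_p·a agree with those in F̄_p
  -- in all cases, since a ≠ 0).

  Alg : Set
  Alg = F × F

  module _ (A : F) where
    mulA : Alg → Alg → Alg
    mulA (u , v) (u' , v') = (u *F u' +F A *F v *F v' , u *F v' +F v *F u')

    scal : F → Alg
    scal x = (x , fromN 0)

    subA : Alg → Alg → Alg
    subA (u , v) (u' , v') = (u -F u' , v -F v')

  -- given the three D_t points (t12,t34), (t13,t24), (t14,t23)
  quadruple : F → F → F → F → Fin 4 → Alg
  quadruple t12 t13 t14 t23 = q
    where
    A : F
    A = (sqF t12 -F fromN 1) *F (sqF t13 -F fromN 1) /F (sqF t23 -F fromN 1)
    a : Alg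
    a = (fromN 0 , fromN 1)
    a⁻¹ : Alg
    a⁻¹ = (fromN 0 , invF A)         -- a · a⁻¹ = 1 (A ≠ 0)
    -- b, c, d determined by ab+1 = t12^2, ac+1 = t13^2, ad+1 = t14^2
    solve : F → Alg
    solve tij = mulA A (subA A (scal A (sqF tij)) (scal A (fromN 1))) a⁻¹
    q : Fin 4 → Alg
    q f0 = a
    q (fs f0) = solve t12
    q (fs (fs f0)) = solve t13
    q (fs (fs (fs f0))) = solve t14

  NotPairwiseDistinct : (Fin 4 → Alg) → Set
  NotPairwiseDistinct q = ∃[ i ] ∃[ j ] (i ≢ j × q i ≡ q j)

module Submission where

-- Call
-- two points (x, y), (x′, y′) of D_t *linked* if x² = x′² or x² = y′².  The
-- proof shows that both sides of the theorem say "two of the Pᵢ are linked".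
--
--   * ResidueRing: F p = Fin p is a commutative ring (its laws are inherited
--     from ℤ through integer representatives), with a ring solver over ℤ.
--   * PrimeField: F p has no zero divisors (Euclid) and invF x = x^(p-2) is
--     the inverse of x ≠ 0 (Fermat, from the binomial theorem).
--   * CurveD: on D_t, translation by R and negation act as the rotation
--     (x, y) ↦ (y, -x) and the mirror (x, y) ↦ (-x, y).  So ±Q′ + kR are the
--     images of the dihedral orbit of P′, which consists exactly of the points
--     linked with P′; the only singular image is φ(0, 0), linked only with
--     itself.  Hence two points are linked iff their images satisfy the pair
--     condition of the theorem (linked⇔pair-condition).
--   * Quadruple: in F p[a], a² = A, the quadruple is a⁻¹ (A, t₁₂² - 1,
--     t₁₃² - 1, t₁₄² - 1), and each coincidence among these four values says
--     that two of the Pᵢ are linked (repeated⇔linked).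

open import Defs
open import Data.Nat using (ℕ; NonZero)
open import Data.Nat.Primality using (Prime)
open import Data.Fin using (Fin; toℕ) renaming (zero to f0; suc to fs)
open import Data.Product using (_×_; _,_; proj₁; proj₂; ∃-syntax; Σ-syntax)
open import Data.Sum using (_⊎_)
open import Relation.Binary.PropositionalEquality using (_≡_; _≢_)
open import Function.Bundles using (_⇔_)

open import Algebra.Bundles using (CommutativeRing; Monoid)
open import Algebra.Structures using (IsCommutativeRing)
open import Algebra.Solver.Ring.AlmostCommutativeRing using (fromCommutativeRing; _-Raw-AlmostCommutative⟶_)
import Algebra.Solver.Ring
open import Data.Empty using (⊥-elim)
open import Data.Fin using (fromℕ; inject₁)
import Data.Fin.Properties as Fin
open import Data.Fin.Properties using () renaming (_≟_ to _≟Fin_)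
open import Data.Integer as ℤ using (ℤ; +_; -[1+_]; _+_; _*_; -_; _-_; _⊖_)
import Data.Integer.Properties as ℤ
open import Data.Integer.Tactic.RingSolver using (solve-∀)
open import Data.Maybe using (just; nothing)
open import Data.Nat as ℕ using (zero; suc; _∸_; _<_; _!)
import Data.Nat.Properties as ℕ
open import Data.Nat.Combinatorics using (_C_; nCn≡1; nCk≡n!/k![n-k]!; k![n∸k]!∣n!)
open import Data.Nat.Divisibility using (_∣_; divides; m%n≡0⇒n∣m; n∣m⇒m%n≡0; ∣⇒≤; m∣m*n)
open import Data.Nat.DivMod using (_%_; _/_; m*n/n≡m; m≡m%n+[m/n]*n; [m+kn]%n≡m%n; m<n⇒m%n≡m)
open import Data.Nat.Primality using (prime⇒nonTrivial; euclidsLemma)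
open import Data.Product using (swap)
open import Data.Product.Properties using (×-≡,≡→≡; ≡-dec)
open import Data.Sum using (inj₁; inj₂)
import Data.Sum as Sum
open import Data.Vec.Functional using (tail; init; last)
open import Function.Base using (id; _∘_)
open import Function.Bundles using (mk⇔; Equivalence)
open import Function.Properties.Equivalence using () renaming (trans to ⇔-trans)
open import Relation.Binary.Definitions using (WeaklyDecidable)
open import Relation.Binary.PropositionalEquality
  using (refl; sym; trans; cong; cong₂; subst; subst₂; isEquivalence; module ≡-Reasoning)
open import Relation.Nullary using (¬_; Dec; yes; no)

module ResidueRing (p : ℕ) .{{_ : NonZero p}} where

  infixl 6 _⊕_ _⊝_
  infixl 7 _⊛_

  _⊕_ _⊛_ _⊝_ : F p → F p → F p
  _⊕_ = _+F_ p
  _⊛_ = _*F_ p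
  _⊝_ = _-F_ p

  neg sq : F p → F p
  neg = negF p
  sq = sqF p

  0F 1F 2F : F p
  0F = fromN p 0
  1F = fromN p 1
  2F = fromN p 2

  ι : F p → ℤ
  ι x = + toℕ x

  record Represents (i : ℤ) (x : F p) : Set where
    constructor via
    field
      multiplier : ℤ
      congruence : ι x ≡ i + multiplier * + p

  ι-represents : ∀ x → Represents (ι x) x
  ι-represents x = via (+ 0) (no-multiple (ι x) (+ p))
    where
    no-multiple : ∀ a m → a ≡ a + + 0 * m
    no-multiple = solve-∀

  fromN-represents : ∀ n → Represents (+ n) (fromN p n)
  fromN-represents n = via (- + (n / p)) (begin
    ι (fromN p n)                                      ≡⟨ cong +_ (Fin.toℕ-fromℕ< _) ⟩
    + (n % p)                                          ≡⟨ cancel (+ (n % p)) (+ (n / p)) (+ p) ⟩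
    + (n % p) + + (n / p) * + p + - + (n / p) * + p    ≡⟨ cong (λ m → m + - + (n / p) * + p) division ⟩
    + n + - + (n / p) * + p                            ∎)
    where
    open ≡-Reasoning
    cancel : ∀ r q m → r ≡ r + q * m + - q * m
    cancel = solve-∀
    division : + (n % p) + + (n / p) * + p ≡ + n
    division = begin
      + (n % p) + + (n / p) * + p      ≡⟨ cong (_+_ (+ (n % p))) (ℤ.pos-* (n / p) p) ⟨
      + (n % p) + + (n / p ℕ.* p)      ≡⟨ ℤ.pos-+ (n % p) _ ⟨
      + (n % p ℕ.+ n / p ℕ.* p)        ≡⟨ cong +_ (m≡m%n+[m/n]*n n p) ⟨
      + n                              ∎

  shift-represents : ∀ {i j x} k → Represents i x → i ≡ j + k * + p → Represents j x
  shift-represents {i} {j} k (via k₀ e₀) i≡j+kp = via (k₀ + k) (begin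
    ι _                       ≡⟨ e₀ ⟩
    i + k₀ * + p              ≡⟨ cong (λ m → m + k₀ * + p) i≡j+kp ⟩
    j + k * + p + k₀ * + p    ≡⟨ regroup j k k₀ (+ p) ⟩
    j + (k₀ + k) * + p        ∎)
    where
    open ≡-Reasoning
    regroup : ∀ j k k₀ m → j + k * m + k₀ * m ≡ j + (k₀ + k) * m
    regroup = solve-∀

  infixl 6 _r+_
  infixl 7 _r*_

  _r+_ : ∀ {i j x y} → Represents i x → Represents j y → Represents (i + j) (x ⊕ y)
  _r+_ {i} {j} {x} {y} (via k₁ e₁) (via k₂ e₂) =
    shift-represents (k₁ + k₂) (fromN-represents (toℕ x ℕ.+ toℕ y)) (begin
      + (toℕ x ℕ.+ toℕ y)               ≡⟨ ℤ.pos-+ (toℕ x) (toℕ y) ⟩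
      ι x + ι y                         ≡⟨ cong₂ _+_ e₁ e₂ ⟩
      (i + k₁ * + p) + (j + k₂ * + p)   ≡⟨ regroup i j k₁ k₂ (+ p) ⟩
      i + j + (k₁ + k₂) * + p           ∎)
    where
    open ≡-Reasoning
    regroup : ∀ i j k₁ k₂ m → (i + k₁ * m) + (j + k₂ * m) ≡ i + j + (k₁ + k₂) * m
    regroup = solve-∀

  _r*_ : ∀ {i j x y} → Represents i x → Represents j y → Represents (i * j) (x ⊛ y)
  _r*_ {i} {j} {x} {y} (via k₁ e₁) (via k₂ e₂) =
    shift-represents (k₁ * j + i * k₂ + k₁ * k₂ * + p) (fromN-represents (toℕ x ℕ.* toℕ y)) (begin
      + (toℕ x ℕ.* toℕ y)                                ≡⟨ ℤ.pos-* (toℕ x) (toℕ y) ⟩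
      ι x * ι y                                          ≡⟨ cong₂ _*_ e₁ e₂ ⟩
      (i + k₁ * + p) * (j + k₂ * + p)                    ≡⟨ expand i j k₁ k₂ (+ p) ⟩
      i * j + (k₁ * j + i * k₂ + k₁ * k₂ * + p) * + p    ∎)
    where
    open ≡-Reasoning
    expand : ∀ i j k₁ k₂ m → (i + k₁ * m) * (j + k₂ * m) ≡ i * j + (k₁ * j + i * k₂ + k₁ * k₂ * m) * m
    expand = solve-∀

  neg-represents : ∀ {i x} → Represents i x → Represents (- i) (neg x)
  neg-represents {i} {x} (via k₁ e₁) =
    shift-represents (+ 1 - k₁) (fromN-represents (p ∸ toℕ x)) (begin
      + (p ∸ toℕ x)               ≡⟨ ℤ.⊖-≥ (ℕ.<⇒≤ (Fin.toℕ<n x)) ⟨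
      p ⊖ toℕ x                   ≡⟨ ℤ.m-n≡m⊖n p (toℕ x) ⟨
      + p - ι x                   ≡⟨ cong (λ m → + p - m) e₁ ⟩
      + p - (i + k₁ * + p)        ≡⟨ regroup i k₁ (+ p) ⟩
      - i + (+ 1 - k₁) * + p      ∎)
    where
    open ≡-Reasoning
    regroup : ∀ i k₁ m → m - (i + k₁ * m) ≡ - i + (+ 1 - k₁) * m
    regroup = solve-∀

  below-p-unique : ∀ {a b} k → a < p → b < p → + a ≡ + b + k * + p → a ≡ b
  below-p-unique {a} {b} (+ k) a<p b<p a≡b+kp =
    differ-by-multiple {k = k} a<p b<p (ℤ.+-injective (trans a≡b+kp (as-ℕ b k)))
    where
    as-ℕ : ∀ b k → + b + + k * + p ≡ + (b ℕ.+ k ℕ.* p)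
    as-ℕ b k = trans (cong (_+_ (+ b)) (sym (ℤ.pos-* k p))) (sym (ℤ.pos-+ b (k ℕ.* p)))
    differ-by-multiple : ∀ {a b k} → a < p → b < p → a ≡ b ℕ.+ k ℕ.* p → a ≡ b
    differ-by-multiple {a} {b} {k} a<p b<p refl = begin
      b ℕ.+ k ℕ.* p            ≡⟨ m<n⇒m%n≡m a<p ⟨
      (b ℕ.+ k ℕ.* p) % p      ≡⟨ [m+kn]%n≡m%n b k p ⟩
      b % p                    ≡⟨ m<n⇒m%n≡m b<p ⟩
      b                        ∎
      where open ≡-Reasoning
  below-p-unique {a} {b} -[1+ k ] a<p b<p a≡b-kp =
    sym (below-p-unique (+ suc k) b<p a<p (solve-for-b (+ a) (+ b) (+ suc k) (+ p) a≡b-kp))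
    where
    solve-for-b : ∀ a b k m → a ≡ b + - k * m → b ≡ a + k * m
    solve-for-b a b k m refl = cancel b k m
      where
      cancel : ∀ b k m → b ≡ b + - k * m + k * m
      cancel = solve-∀

  represents-unique : ∀ {i x y} → Represents i x → Represents i y → x ≡ y
  represents-unique {i} {x} {y} (via k₁ e₁) (via k₂ e₂) =
    Fin.toℕ-injective (below-p-unique (k₁ - k₂) (Fin.toℕ<n x) (Fin.toℕ<n y) (begin
      ι x                               ≡⟨ e₁ ⟩
      i + k₁ * + p                      ≡⟨ regroup i k₁ k₂ (+ p) ⟩
      i + k₂ * + p + (k₁ - k₂) * + p    ≡⟨ cong (λ m → m + (k₁ - k₂) * + p) e₂ ⟨
      ι y + (k₁ - k₂) * + p             ∎))
    where
    open ≡-Reasoning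
    regroup : ∀ i k₁ k₂ m → i + k₁ * m ≡ i + k₂ * m + (k₁ - k₂) * m
    regroup = solve-∀

  -- Residues with equal representatives are equal; in this way every ring law
  -- of F p is inherited from the same law of ℤ.
  by-representatives : ∀ {i j x y} → Represents i x → Represents j y → i ≡ j → x ≡ y
  by-representatives rx ry refl = represents-unique rx ry

  private
    r : ∀ x → Represents (ι x) x
    r = ι-represents

  isCommutativeRing : IsCommutativeRing _≡_ _⊕_ _⊛_ neg 0F 1F
  isCommutativeRing = record
    { isRing = record
      { +-isAbelianGroup = record
        { isGroup = record
          { isMonoid = record
            { isSemigroup = record
              { isMagma = record { isEquivalence = isEquivalence ; ∙-cong = cong₂ _⊕_ }
              ; assoc = λ x y z → by-representatives ((r x r+ r y) r+ r z) (r x r+ (r y r+ r z))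
                                    (ℤ.+-assoc (ι x) (ι y) (ι z)) }
            ; identity = (λ x → by-representatives (fromN-represents 0 r+ r x) (r x) (ℤ.+-identityˡ (ι x)))
                       , (λ x → by-representatives (r x r+ fromN-represents 0) (r x) (ℤ.+-identityʳ (ι x))) }
          ; inverse = (λ x → by-representatives (neg-represents (r x) r+ r x) (fromN-represents 0) (ℤ.+-inverseˡ (ι x)))
                    , (λ x → by-representatives (r x r+ neg-represents (r x)) (fromN-represents 0) (ℤ.+-inverseʳ (ι x)))
          ; ⁻¹-cong = cong neg }
        ; comm = λ x y → by-representatives (r x r+ r y) (r y r+ r x) (ℤ.+-comm (ι x) (ι y)) }
      ; *-cong = cong₂ _⊛_
      ; *-assoc = λ x y z → by-representatives ((r x r* r y) r* r z) (r x r* (r y r* r z))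
                              (ℤ.*-assoc (ι x) (ι y) (ι z))
      ; *-identity = (λ x → by-representatives (fromN-represents 1 r* r x) (r x) (ℤ.*-identityˡ (ι x)))
                   , (λ x → by-representatives (r x r* fromN-represents 1) (r x) (ℤ.*-identityʳ (ι x)))
      ; distrib = (λ x y z → by-representatives (r x r* (r y r+ r z)) ((r x r* r y) r+ (r x r* r z))
                               (ℤ.*-distribˡ-+ (ι x) (ι y) (ι z)))
                , (λ x y z → by-representatives ((r y r+ r z) r* r x) ((r y r* r x) r+ (r z r* r x))
                               (ℤ.*-distribʳ-+ (ι x) (ι y) (ι z))) }
    ; *-comm = λ x y → by-representatives (r x r* r y) (r y r* r x) (ℤ.*-comm (ι x) (ι y)) }

  commutativeRing : CommutativeRing _ _
  commutativeRing = record { isCommutativeRing = isCommutativeRing }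

  -- The canonical ring homomorphism ℤ → F p, through which integer
  -- coefficients enter the ring solver.
  θ : ℤ → F p
  θ (+ n) = fromN p n
  θ -[1+ n ] = neg (fromN p (suc n))

  θ-represents : ∀ i → Represents i (θ i)
  θ-represents (+ n) = fromN-represents n
  θ-represents -[1+ n ] = neg-represents (fromN-represents (suc n))

  θ-+ : ∀ i j → θ (i + j) ≡ θ i ⊕ θ j
  θ-+ i j = by-representatives (θ-represents (i + j)) (θ-represents i r+ θ-represents j) refl

  θ-* : ∀ i j → θ (i * j) ≡ θ i ⊛ θ j
  θ-* i j = by-representatives (θ-represents (i * j)) (θ-represents i r* θ-represents j) refl

  θ-ι : ∀ x → θ (ι x) ≡ x
  θ-ι x = represents-unique (θ-represents (ι x)) (ι-represents x)

  θ-morphism : ℤ.+-*-rawRing -Raw-AlmostCommutative⟶ fromCommutativeRing commutativeRing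
  θ-morphism = record
    { ⟦_⟧ = θ
    ; +-homo = θ-+
    ; *-homo = θ-*
    ; -‿homo = λ i → by-representatives (θ-represents (- i)) (neg-represents (θ-represents i)) refl
    ; 0-homo = refl
    ; 1-homo = refl
    }

  θ-equal? : WeaklyDecidable (λ i j → θ i ≡ θ j)
  θ-equal? i j with i ℤ.≟ j
  ... | yes i≡j = just (cong θ i≡j)
  ... | no _ = nothing

  open Algebra.Solver.Ring ℤ.+-*-rawRing (fromCommutativeRing commutativeRing) θ-morphism θ-equal?
    public using (Polynomial; solve; _:=_; con; _:+_; _:*_; :-_; _:-_)

  lit : ∀ {n} → ℕ → Polynomial n
  lit k = con (+ k)

  *-comm : ∀ a b → a ⊛ b ≡ b ⊛ a
  *-comm = solve 2 (λ a b → a :* b := b :* a) refl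

  sq-neg : ∀ a → sq (neg a) ≡ sq a
  sq-neg = solve 1 (λ a → :- a :* :- a := a :* a) refl

  neg-neg : ∀ a → neg (neg a) ≡ a
  neg-neg = solve 1 (λ a → :- :- a := a) refl

  difference-zero : ∀ {a b} → a ⊝ b ≡ 0F → a ≡ b
  difference-zero {a} {b} a-b≡0 = begin
    a              ≡⟨ solve 2 (λ a b → a := (a :- b) :+ b) refl a b ⟩
    (a ⊝ b) ⊕ b    ≡⟨ cong (_⊕ b) a-b≡0 ⟩
    0F ⊕ b         ≡⟨ solve 1 (λ b → lit 0 :+ b := b) refl b ⟩
    b              ∎
    where open ≡-Reasoning

  shifted-squares⇔ : ∀ a b → (sq a ⊝ 1F ≡ sq b ⊝ 1F) ⇔ (sq a ≡ sq b)
  shifted-squares⇔ a b = mk⇔ unshift (cong (_⊝ 1F))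
    where
    open ≡-Reasoning
    unshift : sq a ⊝ 1F ≡ sq b ⊝ 1F → sq a ≡ sq b
    unshift e = difference-zero (begin
      sq a ⊝ sq b                  ≡⟨ solve 2 (λ a b → a :* a :- b :* b := (a :* a :- lit 1) :- (b :* b :- lit 1)) refl a b ⟩
      (sq a ⊝ 1F) ⊝ (sq b ⊝ 1F)    ≡⟨ cong (_⊝ (sq b ⊝ 1F)) e ⟩
      (sq b ⊝ 1F) ⊝ (sq b ⊝ 1F)    ≡⟨ solve 1 (λ c → c :- c := lit 0) refl (sq b ⊝ 1F) ⟩
      0F                           ∎)

module PrimeField (p : ℕ) .{{_ : NonZero p}} (p-prime : Prime p) where

  open ResidueRing p public

  1<p : 1 < p
  1<p = ℕ.nonTrivial⇒n>1 p {{prime⇒nonTrivial p-prime}}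

  toℕ-fromN : ∀ {n} → n < p → toℕ (fromN p n) ≡ n
  toℕ-fromN n<p = trans (Fin.toℕ-fromℕ< _) (m<n⇒m%n≡m n<p)

  fromN-toℕ : ∀ x → fromN p (toℕ x) ≡ x
  fromN-toℕ x = Fin.toℕ-injective (toℕ-fromN (Fin.toℕ<n x))

  fromN≡0⇔∣ : ∀ n → fromN p n ≡ 0F ⇔ p ∣ n
  fromN≡0⇔∣ n = mk⇔
    (λ n≡0 → m%n≡0⇒n∣m n p (trans (sym (Fin.toℕ-fromℕ< _)) (trans (cong toℕ n≡0) toℕ0)))
    (λ p∣n → Fin.toℕ-injective (trans (Fin.toℕ-fromℕ< _) (trans (n∣m⇒m%n≡0 n p p∣n) (sym toℕ0))))
    where
    toℕ0 : toℕ 0F ≡ 0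
    toℕ0 = toℕ-fromN (ℕ.<-trans ℕ.z<s 1<p)

  fromN-nonzero : ∀ {n} → 0 < n → n < p → fromN p n ≢ 0F
  fromN-nonzero 0<n n<p n≡0 =
    ℕ.<⇒≱ n<p (∣⇒≤ {{ℕ.>-nonZero 0<n}} (Equivalence.to (fromN≡0⇔∣ _) n≡0))

  1≢0 : 1F ≢ 0F
  1≢0 = fromN-nonzero ℕ.z<s 1<p

  2≢0 : p ≢ 2 → 2F ≢ 0F
  2≢0 p≢2 = fromN-nonzero ℕ.z<s (ℕ.≤∧≢⇒< 1<p (λ 2≡p → p≢2 (sym 2≡p)))

  zero-product : ∀ x y → x ⊛ y ≡ 0F → x ≡ 0F ⊎ y ≡ 0F
  zero-product x y xy≡0 =
    Sum.map (divisible⇒0 x) (divisible⇒0 y)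
      (euclidsLemma (toℕ x) (toℕ y) p-prime (Equivalence.to (fromN≡0⇔∣ _) xy≡0))
    where
    divisible⇒0 : ∀ z → p ∣ toℕ z → z ≡ 0F
    divisible⇒0 z p∣z = trans (sym (fromN-toℕ z)) (Equivalence.from (fromN≡0⇔∣ _) p∣z)

  nonzero-product : ∀ {x y} → x ≢ 0F → y ≢ 0F → x ⊛ y ≢ 0F
  nonzero-product x≢0 y≢0 xy≡0 = Sum.[ x≢0 , y≢0 ]′ (zero-product _ _ xy≡0)

  drop-factorˡ : ∀ {a b} → a ≢ 0F → a ⊛ b ≡ 0F → b ≡ 0F
  drop-factorˡ a≢0 ab≡0 = Sum.[ (λ a≡0 → ⊥-elim (a≢0 a≡0)) , id ]′ (zero-product _ _ ab≡0)

  drop-factorʳ : ∀ {a b} → b ≢ 0F → a ⊛ b ≡ 0F → a ≡ 0F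
  drop-factorʳ b≢0 ab≡0 = Sum.[ id , (λ b≡0 → ⊥-elim (b≢0 b≡0)) ]′ (zero-product _ _ ab≡0)

  *-cancelˡ : ∀ {x a b} → x ≢ 0F → x ⊛ a ≡ x ⊛ b → a ≡ b
  *-cancelˡ {x} {a} {b} x≢0 xa≡xb = difference-zero (drop-factorˡ x≢0 (begin
    x ⊛ (a ⊝ b)        ≡⟨ solve 3 (λ x a b → x :* (a :- b) := x :* a :- x :* b) refl x a b ⟩
    x ⊛ a ⊝ x ⊛ b      ≡⟨ cong (_⊝ (x ⊛ b)) xa≡xb ⟩
    x ⊛ b ⊝ x ⊛ b      ≡⟨ solve 1 (λ c → c :- c := lit 0) refl (x ⊛ b) ⟩
    0F                 ∎))
    where open ≡-Reasoning

  *-cancel⇔ : ∀ {x a b} → x ≢ 0F → (x ⊛ a ≡ x ⊛ b) ⇔ (a ≡ b)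
  *-cancel⇔ {x} x≢0 = mk⇔ (*-cancelˡ x≢0) (cong (x ⊛_))

  square-roots : ∀ {a b} → sq a ≡ sq b → a ≡ b ⊎ a ≡ neg b
  square-roots {a} {b} a²≡b² = Sum.map difference-zero sum-zero (zero-product (a ⊝ b) (a ⊕ b) (begin
    (a ⊝ b) ⊛ (a ⊕ b)   ≡⟨ solve 2 (λ a b → (a :- b) :* (a :+ b) := a :* a :- b :* b) refl a b ⟩
    sq a ⊝ sq b         ≡⟨ cong (_⊝ sq b) a²≡b² ⟩
    sq b ⊝ sq b         ≡⟨ solve 1 (λ c → c :- c := lit 0) refl (sq b) ⟩
    0F                  ∎))
    where
    open ≡-Reasoning
    sum-zero : a ⊕ b ≡ 0F → a ≡ neg b
    sum-zero a+b≡0 = difference-zero (trans (solve 2 (λ a b → a :- :- b := a :+ b) refl a b) a+b≡0)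

  open CommutativeRing commutativeRing using (semiring; commutativeSemiring; +-monoid)
  open import Algebra.Properties.Semiring.Exp semiring using (_^_)
  open import Algebra.Definitions.RawMonoid (Monoid.rawMonoid +-monoid) using (sum) renaming (_×_ to _·_)
  open import Algebra.Properties.Monoid.Sum +-monoid using (sum-init-last; sum-cong-≋; sum-replicate-zero)
  open import Algebra.Properties.CommutativeSemiring.Binomial commutativeSemiring using (theorem)

  ·-as-θ : ∀ n z → n · z ≡ θ (+ n) ⊛ z
  ·-as-θ zero z = solve 1 (λ z → lit 0 := lit 0 :* z) refl z
  ·-as-θ (suc n) z = begin
    z ⊕ n · z             ≡⟨ cong (z ⊕_) (·-as-θ n z) ⟩
    z ⊕ θ (+ n) ⊛ z       ≡⟨ solve 2 (λ z a → z :+ a :* z := (lit 1 :+ a) :* z) refl z (θ (+ n)) ⟩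
    (1F ⊕ θ (+ n)) ⊛ z    ≡⟨ cong (_⊛ z) (θ-+ (+ 1) (+ n)) ⟨
    θ (+ suc n) ⊛ z       ∎
    where open ≡-Reasoning

  1^n≡1 : ∀ n → 1F ^ n ≡ 1F
  1^n≡1 zero = refl
  1^n≡1 (suc n) = trans (cong (1F ⊛_) (1^n≡1 n)) (solve 0 (lit 1 :* lit 1 := lit 1) refl)

  binomial-collapse : ∀ n → 0 < n → (∀ k → 0 < k → k < n → θ (+ (n C k)) ≡ 0F) →
                      ∀ y → (y ⊕ 1F) ^ n ≡ y ^ n ⊕ 1F
  binomial-collapse n@(suc m) _ vanish y = begin
    (y ⊕ 1F) ^ n                                          ≡⟨ theorem n y 1F ⟩
    term f0 ⊕ sum (tail term)                             ≡⟨ cong (term f0 ⊕_) (sum-init-last (tail term)) ⟩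
    term f0 ⊕ (sum (init (tail term)) ⊕ last (tail term)) ≡⟨ cong₂ (λ a b → a ⊕ (b ⊕ last (tail term))) first-term inner-terms ⟩
    1F ⊕ (0F ⊕ last (tail term))                          ≡⟨ cong (λ a → 1F ⊕ (0F ⊕ a)) last-term ⟩
    1F ⊕ (0F ⊕ y ^ n)                                     ≡⟨ solve 1 (λ a → lit 1 :+ (lit 0 :+ a) := a :+ lit 1) refl (y ^ n) ⟩
    y ^ n ⊕ 1F                                            ∎
    where
    open ≡-Reasoning
    term : Fin (suc n) → F p
    term k = (n C toℕ k) · ((y ^ toℕ k) ⊛ (1F ^ (n ∸ toℕ k)))
    first-term : term f0 ≡ 1F
    first-term = begin
      1F ⊛ 1F ^ n ⊕ 0F     ≡⟨ cong (λ a → 1F ⊛ a ⊕ 0F) (1^n≡1 n) ⟩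
      1F ⊛ 1F ⊕ 0F         ≡⟨ solve 0 (lit 1 :* lit 1 :+ lit 0 := lit 1) refl ⟩
      1F                   ∎
    inner-terms : sum (init (tail term)) ≡ 0F
    inner-terms = trans (sum-cong-≋ {m} {init (tail term)} {λ _ → 0F} inner-term) (sum-replicate-zero m)
      where
      inner-term : ∀ i → init (tail term) i ≡ 0F
      inner-term i = begin
        (n C k) · X          ≡⟨ ·-as-θ (n C k) X ⟩
        θ (+ (n C k)) ⊛ X    ≡⟨ cong (_⊛ X) (vanish k ℕ.z<s (ℕ.s<s k-1<m)) ⟩
        0F ⊛ X               ≡⟨ solve 1 (λ a → lit 0 :* a := lit 0) refl X ⟩
        0F                   ∎
        where
        k : ℕ
        k = suc (toℕ (inject₁ i))
        X : F p
        X = y ^ k ⊛ 1F ^ (n ∸ k)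
        k-1<m : toℕ (inject₁ i) < m
        k-1<m = subst (_< m) (sym (Fin.toℕ-inject₁ i)) (Fin.toℕ<n i)
    last-term : last (tail term) ≡ y ^ n
    last-term = begin
      (n C suc (toℕ (fromℕ m))) · (y ^ suc (toℕ (fromℕ m)) ⊛ 1F ^ (m ∸ toℕ (fromℕ m)))
        ≡⟨ cong (λ j → (n C suc j) · (y ^ suc j ⊛ 1F ^ (m ∸ j))) (Fin.toℕ-fromℕ m) ⟩
      (n C n) · (y ^ n ⊛ 1F ^ (m ∸ m))
        ≡⟨ cong₂ (λ c e → c · (y ^ n ⊛ 1F ^ e)) (nCn≡1 n) (ℕ.n∸n≡0 m) ⟩
      y ^ n ⊛ 1F ⊕ 0F
        ≡⟨ solve 1 (λ a → a :* lit 1 :+ lit 0 := a) refl (y ^ n) ⟩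
      y ^ n
        ∎

  prime∤factorial : ∀ m → m < p → ¬ p ∣ m !
  prime∤factorial zero m<p p∣1 = ℕ.<⇒≱ 1<p (∣⇒≤ p∣1)
  prime∤factorial (suc m) m<p p∣m! with euclidsLemma (suc m) (m !) p-prime p∣m!
  ... | inj₁ p∣suc-m = ℕ.<⇒≱ m<p (∣⇒≤ p∣suc-m)
  ... | inj₂ p∣m!′ = prime∤factorial m (ℕ.<-trans (ℕ.n<1+n m) m<p) p∣m!′

  -- p divides the inner binomial coefficients p C k, 0 < k < p: writing
  -- p! = q · k! (p - k)!, Euclid's lemma puts p into q = p C k.
  prime∣binomial : ∀ k → 0 < k → k < p → p ∣ p C k
  prime∣binomial k 0<k k<p with k![n∸k]!∣n! (ℕ.<⇒≤ k<p)
  ... | divides q p!≡q·k!·[p-k]! = subst (p ∣_) (sym pCk≡q) p∣q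
    where
    instance
      _ : NonZero (k ! ℕ.* (p ∸ k) !)
      _ = k ℕ.!* (p ∸ k) !≢0
    pCk≡q : p C k ≡ q
    pCk≡q = trans (nCk≡n!/k![n-k]! (ℕ.<⇒≤ k<p))
                  (trans (cong (_/ (k ! ℕ.* (p ∸ k) !)) p!≡q·k!·[p-k]!) (m*n/n≡m q (k ! ℕ.* (p ∸ k) !)))
    n∣n! : ∀ n → 0 < n → n ∣ n !
    n∣n! (suc n) _ = m∣m*n (n !)
    p∣q : p ∣ q
    p∣q with euclidsLemma q _ p-prime (subst (p ∣_) p!≡q·k!·[p-k]! (n∣n! p (ℕ.<-trans ℕ.z<s 1<p)))
    ... | inj₁ p∣q = p∣q
    ... | inj₂ p∣k!·[p-k]! = ⊥-elim (Sum.[ prime∤factorial k k<p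
                                         , prime∤factorial (p ∸ k) (ℕ.∸-monoʳ-< 0<k (ℕ.<⇒≤ k<p)) ]′
                                        (euclidsLemma (k !) ((p ∸ k) !) p-prime p∣k!·[p-k]!))

  frobenius-step : ∀ y → (y ⊕ 1F) ^ p ≡ y ^ p ⊕ 1F
  frobenius-step = binomial-collapse p (ℕ.<-trans ℕ.z<s 1<p)
    (λ k 0<k k<p → Equivalence.from (fromN≡0⇔∣ (p C k)) (prime∣binomial k 0<k k<p))

  fermat : ∀ x → x ^ p ≡ x
  fermat x = trans (cong (_^ p) (sym (θ-ι x))) (trans (fermat-θ (toℕ x)) (θ-ι x))
    where
    fermat-θ : ∀ n → θ (+ n) ^ p ≡ θ (+ n)
    fermat-θ zero = zero-power p (ℕ.<-trans ℕ.z<s 1<p)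
      where
      zero-power : ∀ n → 0 < n → 0F ^ n ≡ 0F
      zero-power (suc n) _ = solve 1 (λ a → lit 0 :* a := lit 0) refl (0F ^ n)
    fermat-θ (suc n) = begin
      θ (+ suc n) ^ p      ≡⟨ cong (_^ p) successor ⟩
      (θ (+ n) ⊕ 1F) ^ p   ≡⟨ frobenius-step (θ (+ n)) ⟩
      θ (+ n) ^ p ⊕ 1F     ≡⟨ cong (_⊕ 1F) (fermat-θ n) ⟩
      θ (+ n) ⊕ 1F         ≡⟨ successor ⟨
      θ (+ suc n)          ∎
      where
      open ≡-Reasoning
      successor : θ (+ suc n) ≡ θ (+ n) ⊕ 1F
      successor = trans (θ-+ (+ 1) (+ n)) (solve 1 (λ a → lit 1 :+ a := a :+ lit 1) refl (θ (+ n)))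

  inverse : ∀ {x} → x ≢ 0F → x ⊛ invF p x ≡ 1F
  inverse {x} x≢0 = *-cancelˡ x≢0 (begin
    x ⊛ (x ⊛ invF p x)     ≡⟨ cong (λ z → x ⊛ (x ⊛ z)) (trans (θ-pow (toℕ x) (p ∸ 2)) (cong (_^ (p ∸ 2)) (θ-ι x))) ⟩
    x ^ suc (suc (p ∸ 2))  ≡⟨ cong (x ^_) (trans (sym (ℕ.+-∸-assoc 2 1<p)) (ℕ.m+n∸m≡n 2 p)) ⟩
    x ^ p                  ≡⟨ fermat x ⟩
    x                      ≡⟨ solve 1 (λ a → a := a :* lit 1) refl x ⟩
    x ⊛ 1F                 ∎)
    where
    open ≡-Reasoning
    θ-pow : ∀ a n → θ (+ (a ℕ.^ n)) ≡ θ (+ a) ^ n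
    θ-pow a zero = refl
    θ-pow a (suc n) = trans (cong θ (ℤ.pos-* a (a ℕ.^ n))) (trans (θ-* (+ a) (+ (a ℕ.^ n))) (cong (θ (+ a) ⊛_) (θ-pow a n)))

  inverse≢0 : ∀ {x} → x ≢ 0F → invF p x ≢ 0F
  inverse≢0 {x} x≢0 inv≡0 = 1≢0 (begin
    1F                ≡⟨ inverse x≢0 ⟨
    x ⊛ invF p x      ≡⟨ cong (x ⊛_) inv≡0 ⟩
    x ⊛ 0F            ≡⟨ solve 1 (λ a → a :* lit 0 := lit 0) refl x ⟩
    0F                ∎)
    where open ≡-Reasoning

  division : ∀ {N D ℓ} → D ≢ 0F → (N ⊛ invF p D ≡ ℓ) ⇔ (N ≡ ℓ ⊛ D)
  division {N} {D} {ℓ} D≢0 = mk⇔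
    (λ N/D≡ℓ → begin
      N                        ≡⟨ solve 1 (λ a → a :* lit 1 := a) refl N ⟨
      N ⊛ 1F                   ≡⟨ cong (N ⊛_) (inverse D≢0) ⟨
      N ⊛ (D ⊛ invF p D)       ≡⟨ solve 3 (λ n d e → n :* (d :* e) := (n :* e) :* d) refl N D (invF p D) ⟩
      (N ⊛ invF p D) ⊛ D       ≡⟨ cong (_⊛ D) N/D≡ℓ ⟩
      ℓ ⊛ D                    ∎)
    (λ N≡ℓD → begin
      N ⊛ invF p D             ≡⟨ cong (_⊛ invF p D) N≡ℓD ⟩
      ℓ ⊛ D ⊛ invF p D         ≡⟨ solve 3 (λ l d e → l :* d :* e := l :* (d :* e)) refl ℓ D (invF p D) ⟩
      ℓ ⊛ (D ⊛ invF p D)       ≡⟨ cong (ℓ ⊛_) (inverse D≢0) ⟩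
      ℓ ⊛ 1F                   ≡⟨ solve 1 (λ a → a :* lit 1 := a) refl ℓ ⟩
      ℓ                        ∎)
    where open ≡-Reasoning

  0-a≢0 : ∀ {a} → a ≢ 0F → 0F ⊝ a ≢ 0F
  0-a≢0 a≢0 0-a≡0 = a≢0 (sym (difference-zero 0-a≡0))

module CurveD (p : ℕ) .{{_ : NonZero p}} (p-prime : Prime p) (p≢2 : p ≢ 2) (t : F p) (t≢0 : t ≢ fromN p 0) where

  open PrimeField p p-prime public

  module _ {n : ℕ} where
    :sq : Polynomial n → Polynomial n
    :sq a = a :* a

    :T : Polynomial n → Polynomial n → Polynomial n
    :T x y = (:sq x :- lit 1) :* (:sq y :- lit 1)

    :U : Polynomial n → Polynomial n → Polynomial n → Polynomial n
    :U x y s = lit 2 :* (:sq x :- lit 1) :* y :+ lit 2 :* :sq x :- (lit 2 :- s)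

    :a₂ : Polynomial n → Polynomial n
    :a₂ s = :- (lit 2 :* (s :- lit 2))

  U : F p → F p → F p → F p
  U x y s = 2F ⊛ (sq x ⊝ 1F) ⊛ y ⊕ 2F ⊛ sq x ⊝ (2F ⊝ s)

  OD : F p → F p → Set
  OD = OnD p t

  -- An identity in t holds at a point (x, y) of D_t as soon as it holds
  -- after substituting t = (x² - 1)(y² - 1); every identity about φ is
  -- obtained this way from a polynomial identity in x, y.
  on-D : ∀ x y (G H : F p → F p) → OD x y →
         G ((sq x ⊝ 1F) ⊛ (sq y ⊝ 1F)) ≡ H ((sq x ⊝ 1F) ⊛ (sq y ⊝ 1F)) → G t ≡ H t
  on-D x y G H onD = subst (λ s → G s ≡ H s) onD

  OnD-swap : ∀ x y → OD x y → OD y x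
  OnD-swap x y onD = trans (*-comm (sq y ⊝ 1F) (sq x ⊝ 1F)) onD

  φ-on-curve : ∀ x y → OD x y → OnE p t (φ p t x y)
  φ-on-curve x y onD =
    on-D x y (λ s → sq (2F ⊛ U x y s ⊛ x)) (λ s → U x y s ⊛ sq (U x y s) ⊕ a2 p s ⊛ sq (U x y s) ⊕ a4 p s ⊛ U x y s) onD
      (solve 2 (λ x y → let T = :T x y ; u = :U x y T in
        :sq (lit 2 :* u :* x) := u :* :sq u :+ :a₂ T :* :sq u :+ :sq T :* u) refl x y)

  x²-1≢0 : ∀ x y → OD x y → sq x ⊝ 1F ≢ 0F
  x²-1≢0 x y onD x²-1≡0 = t≢0 (begin
    t                              ≡⟨ onD ⟨
    (sq x ⊝ 1F) ⊛ (sq y ⊝ 1F)      ≡⟨ cong (_⊛ (sq y ⊝ 1F)) x²-1≡0 ⟩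
    0F ⊛ (sq y ⊝ 1F)               ≡⟨ solve 1 (λ a → lit 0 :* a := lit 0) refl (sq y ⊝ 1F) ⟩
    0F                             ∎)
    where open ≡-Reasoning

  y+1≢0 : ∀ x y → OD x y → y ⊕ 1F ≢ 0F
  y+1≢0 x y onD y+1≡0 = x²-1≢0 y x (OnD-swap x y onD) (begin
    sq y ⊝ 1F                ≡⟨ solve 1 (λ y → :sq y :- lit 1 := (y :- lit 1) :* (y :+ lit 1)) refl y ⟩
    (y ⊝ 1F) ⊛ (y ⊕ 1F)      ≡⟨ cong ((y ⊝ 1F) ⊛_) y+1≡0 ⟩
    (y ⊝ 1F) ⊛ 0F            ≡⟨ solve 1 (λ a → a :* lit 0 := lit 0) refl (y ⊝ 1F) ⟩
    0F                       ∎)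
    where open ≡-Reasoning

  -- On D_t the U-coordinate of φ factors as (x² - 1)(y + 1)², hence is nonzero.
  U-nonzero : ∀ x y → OD x y → U x y t ≢ 0F
  U-nonzero x y onD U≡0 =
    nonzero-product (x²-1≢0 x y onD) (nonzero-product (y+1≢0 x y onD) (y+1≢0 x y onD)) (trans (sym factorisation) U≡0)
    where
    factorisation : U x y t ≡ (sq x ⊝ 1F) ⊛ sq (y ⊕ 1F)
    factorisation = on-D x y (U x y) (λ _ → (sq x ⊝ 1F) ⊛ sq (y ⊕ 1F)) onD
      (solve 2 (λ x y → :U x y (:T x y) := (:sq x :- lit 1) :* :sq (y :+ lit 1)) refl x y)

  -- φ is injective on D_t: x = V / 2U, and then U determines y.
  φ-injective : ∀ {x y x′ y′} → OD x y → φ p t x y ≡ φ p t x′ y′ → (x , y) ≡ (x′ , y′)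
  φ-injective {x} {y} {x′} {y′} onD φ≡φ′ = ×-≡,≡→≡ (x≡x′ , y≡y′)
    where
    U≡U′ : U x y t ≡ U x′ y′ t
    U≡U′ = cong (λ { O → 0F ; (aff u _) → u }) φ≡φ′
    V≡V′ : 2F ⊛ U x y t ⊛ x ≡ 2F ⊛ U x′ y′ t ⊛ x′
    V≡V′ = cong (λ { O → 0F ; (aff _ v) → v }) φ≡φ′
    x≡x′ : x ≡ x′
    x≡x′ = *-cancelˡ (nonzero-product (2≢0 p≢2) (U-nonzero x y onD))
             (trans V≡V′ (cong (λ u → 2F ⊛ u ⊛ x′) (sym U≡U′)))
    y≡y′ : y ≡ y′
    y≡y′ = *-cancelˡ (nonzero-product (2≢0 p≢2) (x²-1≢0 x y onD)) (begin
      2F ⊛ (sq x ⊝ 1F) ⊛ y               ≡⟨ isolate y ⟩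
      U x y t ⊝ 2F ⊛ sq x ⊕ (2F ⊝ t)     ≡⟨ cong (λ u → u ⊝ 2F ⊛ sq x ⊕ (2F ⊝ t)) (trans U≡U′ (cong (λ z → U z y′ t) (sym x≡x′))) ⟩
      U x y′ t ⊝ 2F ⊛ sq x ⊕ (2F ⊝ t)    ≡⟨ isolate y′ ⟨
      2F ⊛ (sq x ⊝ 1F) ⊛ y′              ∎)
      where
      open ≡-Reasoning
      isolate : ∀ z → 2F ⊛ (sq x ⊝ 1F) ⊛ z ≡ U x z t ⊝ 2F ⊛ sq x ⊕ (2F ⊝ t)
      isolate z = solve 3 (λ x z s → lit 2 :* (:sq x :- lit 1) :* z := :U x z s :- lit 2 :* :sq x :+ (lit 2 :- s)) refl x z t

  ∂U : F p → F p
  ∂U u = fromN p 3 ⊛ sq u ⊕ 2F ⊛ a2 p t ⊛ u ⊕ a4 p t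

  -- φ(x, y) is singular exactly when (x, y) = (0, 0): the V-derivative 4Ux
  -- forces x = 0, and then the U-derivative is 4y(y + 1)².
  φ-singular⇔origin : ∀ x y → OD x y → Singular p t (φ p t x y) ⇔ (x , y) ≡ (0F , 0F)
  φ-singular⇔origin x y onD = mk⇔ to from
    where
    ∂U-at-x=0 : ∀ y → OD 0F y → ∂U (U 0F y t) ≡ 2F ⊛ 2F ⊛ y ⊛ sq (y ⊕ 1F)
    ∂U-at-x=0 y onD₀ =
      on-D 0F y (λ s → fromN p 3 ⊛ sq (U 0F y s) ⊕ 2F ⊛ a2 p s ⊛ U 0F y s ⊕ a4 p s) (λ _ → 2F ⊛ 2F ⊛ y ⊛ sq (y ⊕ 1F)) onD₀
        (solve 1 (λ y → let T = :T (lit 0) y ; u = :U (lit 0) y T in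
          lit 3 :* :sq u :+ lit 2 :* :a₂ T :* u :+ :sq T := lit 2 :* lit 2 :* y :* :sq (y :+ lit 1)) refl y)
    to : Singular p t (φ p t x y) → (x , y) ≡ (0F , 0F)
    to (∂V≡0 , ∂U≡0) = ×-≡,≡→≡ (x≡0 , y≡0)
      where
      x≡0 : x ≡ 0F
      x≡0 = drop-factorˡ (nonzero-product (2≢0 p≢2) (U-nonzero x y onD)) (drop-factorˡ (2≢0 p≢2) ∂V≡0)
      onD₀ : OD 0F y
      onD₀ = subst (λ z → OD z y) x≡0 onD
      y≡0 : y ≡ 0F
      y≡0 = drop-factorˡ (nonzero-product (2≢0 p≢2) (2≢0 p≢2))
              (drop-factorʳ (nonzero-product (y+1≢0 0F y onD₀) (y+1≢0 0F y onD₀))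
                (trans (sym (∂U-at-x=0 y onD₀)) (subst (λ z → ∂U (U z y t) ≡ 0F) x≡0 ∂U≡0)))
    from : (x , y) ≡ (0F , 0F) → Singular p t (φ p t x y)
    from refl =
        solve 1 (λ u → lit 2 :* (lit 2 :* u :* lit 0) := lit 0) refl (U 0F 0F t)
      , trans (∂U-at-x=0 0F onD) (solve 0 (lit 2 :* lit 2 :* lit 0 :* :sq (lit 0 :+ lit 1) := lit 0) refl)

  -- The sum of (x₁, y₁) and the point of abscissa x₂ on the line of slope ℓ
  -- through it: the reflection of the third intersection with E_t.
  chord-point : F p → F p → F p → F p → Pt p
  chord-point x₁ y₁ x₂ ℓ = aff x₃ (neg (y₁ ⊕ ℓ ⊛ (x₃ ⊝ x₁)))
    where
    x₃ : F p
    x₃ = sq ℓ ⊝ a2 p t ⊝ x₁ ⊝ x₂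

  -- An opaque copy of chord-point, used in the statements of the chord and
  -- tangent rules so that the case analyses on addPt do not unfold it.
  opaque
    third-point : F p → F p → F p → F p → Pt p
    third-point = chord-point

    third-point-unfold : ∀ x₁ y₁ x₂ ℓ → third-point x₁ y₁ x₂ ℓ ≡ chord-point x₁ y₁ x₂ ℓ
    third-point-unfold _ _ _ _ = refl

  secant-sum : ∀ x₁ y₁ x₂ y₂ ℓ → x₂ ⊝ x₁ ≢ 0F → y₂ ⊝ y₁ ≡ ℓ ⊛ (x₂ ⊝ x₁) →
               addPt p t (aff x₁ y₁) (aff x₂ y₂) ≡ third-point x₁ y₁ x₂ ℓ
  secant-sum x₁ y₁ x₂ y₂ ℓ x₂-x₁≢0 rise≡ℓrun with x₁ ≟Fin x₂
  ... | yes x₁≡x₂ = ⊥-elim (x₂-x₁≢0 (trans (cong (x₂ ⊝_) x₁≡x₂) (solve 1 (λ a → a :- a := lit 0) refl x₂)))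
  ... | no _ = trans (cong (chord-point x₁ y₁ x₂) (Equivalence.from (division {ℓ = ℓ} x₂-x₁≢0) rise≡ℓrun))
                     (sym (third-point-unfold x₁ y₁ x₂ ℓ))

  tangent-sum : ∀ x₁ y₁ ℓ → 2F ⊛ y₁ ≢ 0F → ∂U x₁ ≡ ℓ ⊛ (2F ⊛ y₁) →
                addPt p t (aff x₁ y₁) (aff x₁ y₁) ≡ third-point x₁ y₁ x₁ ℓ
  tangent-sum x₁ y₁ ℓ 2y₁≢0 ∂U≡ℓ·2y₁ with x₁ ≟Fin x₁
  ... | no x₁≢x₁ = ⊥-elim (x₁≢x₁ refl)
  ... | yes _ with y₁ ≟Fin neg y₁
  ...   | yes y₁≡-y₁ = ⊥-elim (2y₁≢0 (begin
          2F ⊛ y₁       ≡⟨ solve 1 (λ a → lit 2 :* a := a :+ a) refl y₁ ⟩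
          y₁ ⊕ y₁       ≡⟨ cong (_⊕ y₁) y₁≡-y₁ ⟩
          neg y₁ ⊕ y₁   ≡⟨ solve 1 (λ a → :- a :+ a := lit 0) refl y₁ ⟩
          0F            ∎))
          where open ≡-Reasoning
  ...   | no _ = trans (cong (chord-point x₁ y₁ x₁) (Equivalence.from (division {ℓ = ℓ} 2y₁≢0) ∂U≡ℓ·2y₁))
                       (sym (third-point-unfold x₁ y₁ x₁ ℓ))

  -- 2R = (0, 0): the tangent at R = (t, 2t) has slope 2.
  2R≡origin : mulR p t 2 ≡ aff 0F 0F
  2R≡origin = begin
    addPt p t (aff t (2F ⊛ t)) (aff t (2F ⊛ t))
      ≡⟨ tangent-sum t (2F ⊛ t) 2F (nonzero-product (2≢0 p≢2) (nonzero-product (2≢0 p≢2) t≢0))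
           (solve 1 (λ t → lit 3 :* :sq t :+ lit 2 :* :a₂ t :* t :+ :sq t := lit 2 :* (lit 2 :* (lit 2 :* t))) refl t) ⟩
    third-point t (2F ⊛ t) t 2F
      ≡⟨ third-point-unfold t (2F ⊛ t) t 2F ⟩
    chord-point t (2F ⊛ t) t 2F
      ≡⟨ cong₂ aff (solve 1 (λ t → :sq (lit 2) :- :a₂ t :- t :- t := lit 0) refl t)
                   (solve 1 (λ t → :- (lit 2 :* t :+ lit 2 :* ((:sq (lit 2) :- :a₂ t :- t :- t) :- t)) := lit 0) refl t) ⟩
    aff 0F 0F
      ∎
    where open ≡-Reasoning

  -- 3R = (t, -2t) = -R: the chord through R and (0, 0) has slope 2.
  3R≡-R : mulR p t 3 ≡ aff t (neg (2F ⊛ t))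
  3R≡-R = begin
    addPt p t (aff t (2F ⊛ t)) (mulR p t 2)
      ≡⟨ cong (addPt p t (aff t (2F ⊛ t))) 2R≡origin ⟩
    addPt p t (aff t (2F ⊛ t)) (aff 0F 0F)
      ≡⟨ secant-sum t (2F ⊛ t) 0F 0F 2F (0-a≢0 t≢0) (solve 1 (λ t → lit 0 :- lit 2 :* t := lit 2 :* (lit 0 :- t)) refl t) ⟩
    third-point t (2F ⊛ t) 0F 2F
      ≡⟨ third-point-unfold t (2F ⊛ t) 0F 2F ⟩
    chord-point t (2F ⊛ t) 0F 2F
      ≡⟨ cong₂ aff (solve 1 (λ t → :sq (lit 2) :- :a₂ t :- t :- lit 0 := t) refl t)
                   (solve 1 (λ t → :- (lit 2 :* t :+ lit 2 :* ((:sq (lit 2) :- :a₂ t :- t :- lit 0) :- t)) := :- (lit 2 :* t)) refl t) ⟩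
    aff t (neg (2F ⊛ t))
      ∎
    where open ≡-Reasoning

  φ-plus : ∀ x y x₂ y₂ ℓ x′ y′ → x₂ ⊝ U x y t ≢ 0F →
           y₂ ⊝ 2F ⊛ U x y t ⊛ x ≡ ℓ ⊛ (x₂ ⊝ U x y t) →
           sq ℓ ⊝ a2 p t ⊝ U x y t ⊝ x₂ ≡ U x′ y′ t →
           neg (2F ⊛ U x y t ⊛ x ⊕ ℓ ⊛ (U x′ y′ t ⊝ U x y t)) ≡ 2F ⊛ U x′ y′ t ⊛ x′ →
           addPt p t (φ p t x y) (aff x₂ y₂) ≡ φ p t x′ y′
  φ-plus x y x₂ y₂ ℓ x′ y′ run≢0 rise≡ℓrun U₃≡U′ V₃≡V′ = begin
    addPt p t (φ p t x y) (aff x₂ y₂)     ≡⟨ secant-sum (U x y t) (2F ⊛ U x y t ⊛ x) x₂ y₂ ℓ run≢0 rise≡ℓrun ⟩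
    third-point (U x y t) (2F ⊛ U x y t ⊛ x) x₂ ℓ  ≡⟨ third-point-unfold (U x y t) (2F ⊛ U x y t ⊛ x) x₂ ℓ ⟩
    chord-point (U x y t) (2F ⊛ U x y t ⊛ x) x₂ ℓ  ≡⟨ cong₂ aff U₃≡U′ (trans (cong (λ u → neg (2F ⊛ U x y t ⊛ x ⊕ ℓ ⊛ (u ⊝ U x y t))) U₃≡U′) V₃≡V′) ⟩
    φ p t x′ y′                           ∎
    where open ≡-Reasoning

  -- t - U = -2(x² - 1)(y + 1) ≠ 0 on D_t.
  t-U≢0 : ∀ x y → OD x y → t ⊝ U x y t ≢ 0F
  t-U≢0 x y onD t-U≡0 =
    nonzero-product (nonzero-product (2≢0 p≢2) (x²-1≢0 x y onD)) (y+1≢0 x y onD) (begin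
      2F ⊛ (sq x ⊝ 1F) ⊛ (y ⊕ 1F)   ≡⟨ factorisation ⟩
      neg (t ⊝ U x y t)             ≡⟨ cong neg t-U≡0 ⟩
      neg 0F                        ≡⟨ solve 0 (:- lit 0 := lit 0) refl ⟩
      0F                            ∎)
    where
    open ≡-Reasoning
    factorisation : 2F ⊛ (sq x ⊝ 1F) ⊛ (y ⊕ 1F) ≡ neg (t ⊝ U x y t)
    factorisation = on-D x y (λ _ → 2F ⊛ (sq x ⊝ 1F) ⊛ (y ⊕ 1F)) (λ s → neg (s ⊝ U x y s)) onD
      (solve 2 (λ x y → lit 2 :* (:sq x :- lit 1) :* (y :+ lit 1) := :- (:T x y :- :U x y (:T x y))) refl x y)

  -- φ(x, y) + R = φ(y, -x), along the line of slope xy + x - y + 1.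
  φ-plus-R : ∀ x y → OD x y → addPt p t (φ p t x y) (mulR p t 1) ≡ φ p t y (neg x)
  φ-plus-R x y onD = φ-plus x y t (2F ⊛ t) ℓ y (neg x) (t-U≢0 x y onD)
    (on-D x y (λ s → 2F ⊛ s ⊝ 2F ⊛ U x y s ⊛ x) (λ s → ℓ ⊛ (s ⊝ U x y s)) onD
      (solve 2 (λ x y → let T = :T x y in
        lit 2 :* T :- lit 2 :* :U x y T :* x := :ℓ x y :* (T :- :U x y T)) refl x y))
    (on-D x y (λ s → sq ℓ ⊝ a2 p s ⊝ U x y s ⊝ s) (U y (neg x)) onD
      (solve 2 (λ x y → let T = :T x y in
        :sq (:ℓ x y) :- :a₂ T :- :U x y T :- T := :U y (:- x) T) refl x y))
    (on-D x y (λ s → neg (2F ⊛ U x y s ⊛ x ⊕ ℓ ⊛ (U y (neg x) s ⊝ U x y s))) (λ s → 2F ⊛ U y (neg x) s ⊛ y) onD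
      (solve 2 (λ x y → let T = :T x y in
        :- (lit 2 :* :U x y T :* x :+ :ℓ x y :* (:U y (:- x) T :- :U x y T)) := lit 2 :* :U y (:- x) T :* y) refl x y))
    where
    :ℓ : Polynomial 2 → Polynomial 2 → Polynomial 2
    :ℓ x y = x :* y :+ x :- y :+ lit 1
    ℓ : F p
    ℓ = x ⊛ y ⊕ x ⊝ y ⊕ 1F

  -- φ(x, y) + 2R = φ(-x, -y), along the line of slope 2x through (0, 0).
  φ-plus-2R : ∀ x y → OD x y → addPt p t (φ p t x y) (mulR p t 2) ≡ φ p t (neg x) (neg y)
  φ-plus-2R x y onD = trans (cong (addPt p t (φ p t x y)) 2R≡origin) (φ-plus x y 0F 0F (2F ⊛ x) (neg x) (neg y)
    (0-a≢0 (U-nonzero x y onD))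
    (solve 2 (λ u x → lit 0 :- lit 2 :* u :* x := lit 2 :* x :* (lit 0 :- u)) refl (U x y t) x)
    (on-D x y (λ s → sq (2F ⊛ x) ⊝ a2 p s ⊝ U x y s ⊝ 0F) (U (neg x) (neg y)) onD
      (solve 2 (λ x y → let T = :T x y in
        :sq (lit 2 :* x) :- :a₂ T :- :U x y T :- lit 0 := :U (:- x) (:- y) T) refl x y))
    (on-D x y (λ s → neg (2F ⊛ U x y s ⊛ x ⊕ 2F ⊛ x ⊛ (U (neg x) (neg y) s ⊝ U x y s)))
              (λ s → 2F ⊛ U (neg x) (neg y) s ⊛ neg x) onD
      (solve 2 (λ x y → let T = :T x y in
        :- (lit 2 :* :U x y T :* x :+ lit 2 :* x :* (:U (:- x) (:- y) T :- :U x y T))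
          := lit 2 :* :U (:- x) (:- y) T :* (:- x)) refl x y)))

  -- φ(x, y) + 3R = φ(-y, x), along the line of slope xy + x + y - 1.
  φ-plus-3R : ∀ x y → OD x y → addPt p t (φ p t x y) (mulR p t 3) ≡ φ p t (neg y) x
  φ-plus-3R x y onD = trans (cong (addPt p t (φ p t x y)) 3R≡-R) (φ-plus x y t (neg (2F ⊛ t)) ℓ (neg y) x
    (t-U≢0 x y onD)
    (on-D x y (λ s → neg (2F ⊛ s) ⊝ 2F ⊛ U x y s ⊛ x) (λ s → ℓ ⊛ (s ⊝ U x y s)) onD
      (solve 2 (λ x y → let T = :T x y in
        :- (lit 2 :* T) :- lit 2 :* :U x y T :* x := :ℓ x y :* (T :- :U x y T)) refl x y))
    (on-D x y (λ s → sq ℓ ⊝ a2 p s ⊝ U x y s ⊝ s) (U (neg y) x) onD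
      (solve 2 (λ x y → let T = :T x y in
        :sq (:ℓ x y) :- :a₂ T :- :U x y T :- T := :U (:- y) x T) refl x y))
    (on-D x y (λ s → neg (2F ⊛ U x y s ⊛ x ⊕ ℓ ⊛ (U (neg y) x s ⊝ U x y s))) (λ s → 2F ⊛ U (neg y) x s ⊛ neg y) onD
      (solve 2 (λ x y → let T = :T x y in
        :- (lit 2 :* :U x y T :* x :+ :ℓ x y :* (:U (:- y) x T :- :U x y T)) := lit 2 :* :U (:- y) x T :* (:- y)) refl x y)))
    where
    :ℓ : Polynomial 2 → Polynomial 2 → Polynomial 2
    :ℓ x y = x :* y :+ x :+ y :- lit 1
    ℓ : F p
    ℓ = x ⊛ y ⊕ x ⊕ y ⊝ 1F

  φ-neg : ∀ x y → negPt p (φ p t x y) ≡ φ p t (neg x) y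
  φ-neg x y = cong₂ aff (solve 3 (λ x y s → :U x y s := :U (:- x) y s) refl x y t)
                        (solve 3 (λ x y s → :- (lit 2 :* :U x y s :* x) := lit 2 :* :U (:- x) y s :* (:- x)) refl x y t)

  OnDₚ : F p × F p → Set
  OnDₚ P = OD (proj₁ P) (proj₂ P)

  φₚ : F p × F p → Pt p
  φₚ P = φ p t (proj₁ P) (proj₂ P)

  origin : F p × F p
  origin = 0F , 0F

  rotate : Fin 4 → F p × F p → F p × F p
  rotate f0 (x , y) = x , y
  rotate (fs f0) (x , y) = y , neg x
  rotate (fs (fs f0)) (x , y) = neg x , neg y
  rotate (fs (fs (fs f0))) (x , y) = neg y , x

  mirror : F p × F p → F p × F p
  mirror (x , y) = neg x , y

  OnD-mirror : ∀ P → OnDₚ P → OnDₚ (mirror P)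
  OnD-mirror (x , y) onD = trans (cong (λ a → (a ⊝ 1F) ⊛ (sq y ⊝ 1F)) (sq-neg x)) onD

  φ-translate : ∀ k P → OnDₚ P → addPt p t (φₚ P) (mulR p t (toℕ k)) ≡ φₚ (rotate k P)
  φ-translate f0 (x , y) onD = refl
  φ-translate (fs f0) (x , y) = φ-plus-R x y
  φ-translate (fs (fs f0)) (x , y) = φ-plus-2R x y
  φ-translate (fs (fs (fs f0))) (x , y) = φ-plus-3R x y

  InOrbit : Pt p → Pt p → Set
  InOrbit Q Q′ = Σ[ k ∈ Fin 4 ] (Q ≡ addPt p t Q′ (mulR p t (toℕ k)) ⊎ Q ≡ addPt p t (negPt p Q′) (mulR p t (toℕ k)))

  Dihedral : F p × F p → F p × F p → Set
  Dihedral P P′ = Σ[ k ∈ Fin 4 ] (P ≡ rotate k P′ ⊎ P ≡ rotate k (mirror P′))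

  orbit⇔dihedral : ∀ P P′ → OnDₚ P → OnDₚ P′ → InOrbit (φₚ P) (φₚ P′) ⇔ Dihedral P P′
  orbit⇔dihedral P P′@(x′ , y′) onD onD′ = mk⇔
    (λ { (k , inj₁ Q≡Q′+kR) → k , inj₁ (φ-injective onD (trans Q≡Q′+kR (φ-translate k P′ onD′)))
       ; (k , inj₂ Q≡-Q′+kR) → k , inj₂ (φ-injective onD (trans Q≡-Q′+kR (negated k))) })
    (λ { (k , inj₁ P≡rotP′) → k , inj₁ (trans (cong φₚ P≡rotP′) (sym (φ-translate k P′ onD′)))
       ; (k , inj₂ P≡rot-P′) → k , inj₂ (trans (cong φₚ P≡rot-P′) (sym (negated k))) })
    where
    negated : ∀ k → addPt p t (negPt p (φₚ P′)) (mulR p t (toℕ k)) ≡ φₚ (rotate k (mirror P′))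
    negated k = trans (cong (λ Q → addPt p t Q (mulR p t (toℕ k))) (φ-neg x′ y′))
                      (φ-translate k (mirror P′) (OnD-mirror P′ onD′))

  other-coordinate : ∀ x y x′ y′ → OD x y → OD x′ y′ → sq x ≡ sq x′ → sq y ≡ sq y′
  other-coordinate x y x′ y′ onD onD′ x²≡x′² =
    Equivalence.to (shifted-squares⇔ y y′) (*-cancelˡ (x²-1≢0 x y onD) (begin
      (sq x ⊝ 1F) ⊛ (sq y ⊝ 1F)     ≡⟨ onD ⟩
      t                             ≡⟨ onD′ ⟨
      (sq x′ ⊝ 1F) ⊛ (sq y′ ⊝ 1F)   ≡⟨ cong (λ a → (a ⊝ 1F) ⊛ (sq y′ ⊝ 1F)) x²≡x′² ⟨
      (sq x ⊝ 1F) ⊛ (sq y′ ⊝ 1F)    ∎))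
    where open ≡-Reasoning

  -- Points of D_t sharing a squared coordinate; by other-coordinate they
  -- then have the same set of squared coordinates.
  Linked : F p × F p → F p × F p → Set
  Linked P P′ = sq (proj₁ P) ≡ sq (proj₁ P′) ⊎ sq (proj₁ P) ≡ sq (proj₂ P′)

  dihedral⇒linked : ∀ P P′ → Dihedral P P′ → Linked P P′
  dihedral⇒linked P P′ (k , inj₁ refl) = rotation-linked k P′
    where
    rotation-linked : ∀ k P → Linked (rotate k P) P
    rotation-linked f0 (x , y) = inj₁ refl
    rotation-linked (fs f0) (x , y) = inj₂ refl
    rotation-linked (fs (fs f0)) (x , y) = inj₁ (sq-neg x)
    rotation-linked (fs (fs (fs f0))) (x , y) = inj₂ (sq-neg y)
  dihedral⇒linked P (x′ , y′) (k , inj₂ refl) =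
    Sum.map₁ (λ e → trans e (sq-neg x′)) (dihedral⇒linked _ (neg x′ , y′) (k , inj₁ refl))

  linked⇒dihedral : ∀ P P′ → OnDₚ P → OnDₚ P′ → Linked P P′ → Dihedral P P′
  linked⇒dihedral (x , y) (x′ , y′) onD onD′ (inj₁ x²≡x′²) =
    same-squares (square-roots x²≡x′²) (square-roots (other-coordinate x y x′ y′ onD onD′ x²≡x′²))
    where
    same-squares : x ≡ x′ ⊎ x ≡ neg x′ → y ≡ y′ ⊎ y ≡ neg y′ → Dihedral (x , y) (x′ , y′)
    same-squares (inj₁ x≡x′) (inj₁ y≡y′) = f0 , inj₁ (×-≡,≡→≡ (x≡x′ , y≡y′))
    same-squares (inj₂ x≡-x′) (inj₁ y≡y′) = f0 , inj₂ (×-≡,≡→≡ (x≡-x′ , y≡y′))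
    same-squares (inj₂ x≡-x′) (inj₂ y≡-y′) = fs (fs f0) , inj₁ (×-≡,≡→≡ (x≡-x′ , y≡-y′))
    same-squares (inj₁ x≡x′) (inj₂ y≡-y′) = fs (fs f0) , inj₂ (×-≡,≡→≡ (trans x≡x′ (sym (neg-neg x′)) , y≡-y′))
  linked⇒dihedral (x , y) (x′ , y′) onD onD′ (inj₂ x²≡y′²) =
    swapped-squares (square-roots x²≡y′²) (square-roots (other-coordinate x y y′ x′ onD (OnD-swap x′ y′ onD′) x²≡y′²))
    where
    swapped-squares : x ≡ y′ ⊎ x ≡ neg y′ → y ≡ x′ ⊎ y ≡ neg x′ → Dihedral (x , y) (x′ , y′)
    swapped-squares (inj₁ x≡y′) (inj₂ y≡-x′) = fs f0 , inj₁ (×-≡,≡→≡ (x≡y′ , y≡-x′))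
    swapped-squares (inj₁ x≡y′) (inj₁ y≡x′) = fs f0 , inj₂ (×-≡,≡→≡ (x≡y′ , trans y≡x′ (sym (neg-neg x′))))
    swapped-squares (inj₂ x≡-y′) (inj₁ y≡x′) = fs (fs (fs f0)) , inj₁ (×-≡,≡→≡ (x≡-y′ , y≡x′))
    swapped-squares (inj₂ x≡-y′) (inj₂ y≡-x′) = fs (fs (fs f0)) , inj₂ (×-≡,≡→≡ (x≡-y′ , y≡-x′))

  -- If the origin lies on D_t (that is, t = 1), it is the only point of D_t
  -- with a zero coordinate, hence the only point linked with it.
  vanishes-with-origin : ∀ x y → OnDₚ origin → OD x y → sq x ≡ sq 0F → (x , y) ≡ origin
  vanishes-with-origin x y onD₀ onD x²≡0² =
    ×-≡,≡→≡ (square-zero x²≡0² , square-zero (other-coordinate x y 0F 0F onD onD₀ x²≡0²))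
    where
    square-zero : ∀ {a} → sq a ≡ sq 0F → a ≡ 0F
    square-zero a²≡0² = Sum.[ id , (λ a≡-0 → trans a≡-0 (solve 0 (:- lit 0 := lit 0) refl)) ]′ (square-roots a²≡0²)

  linked-with-origin : ∀ P → OnDₚ origin → OnDₚ P → Linked P origin → P ≡ origin
  linked-with-origin (x , y) onD₀ onD linked = vanishes-with-origin x y onD₀ onD (Sum.[ id , id ]′ linked)

  origin-linked : ∀ P → OnDₚ origin → OnDₚ P → Linked origin P → P ≡ origin
  origin-linked (x , y) onD₀ onD (inj₁ 0²≡x²) = vanishes-with-origin x y onD₀ onD (sym 0²≡x²)
  origin-linked (x , y) onD₀ onD (inj₂ 0²≡y²) =
    cong swap (vanishes-with-origin y x onD₀ (OnD-swap x y onD) (sym 0²≡y²))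

  PairCondition : Pt p → Pt p → Set
  PairCondition Q Q′ = (Nonsingular p t Q × Nonsingular p t Q′ × InOrbit Q Q′) ⊎ (Singular p t Q × Singular p t Q′)

  linked⇔pair-condition : ∀ P P′ → OnDₚ P → OnDₚ P′ → Linked P P′ ⇔ PairCondition (φₚ P) (φₚ P′)
  linked⇔pair-condition P P′ onD onD′ = mk⇔ (λ linked → by-cases linked (≡-dec _≟Fin_ _≟Fin_ P origin)) from
    where
    singular⇔origin : ∀ P → OnDₚ P → Singular p t (φₚ P) ⇔ P ≡ origin
    singular⇔origin (x , y) = φ-singular⇔origin x y
    by-cases : Linked P P′ → Dec (P ≡ origin) → PairCondition (φₚ P) (φₚ P′)
    by-cases linked (yes P≡origin) =
      inj₂ ( Equivalence.from (singular⇔origin P onD) P≡origin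
           , Equivalence.from (singular⇔origin P′ onD′)
               (origin-linked P′ (subst OnDₚ P≡origin onD) onD′ (subst (λ P → Linked P P′) P≡origin linked)))
    by-cases linked (no P≢origin) =
      inj₁ ( (φ-on-curve _ _ onD , P≢origin ∘ Equivalence.to (singular⇔origin P onD))
           , (φ-on-curve _ _ onD′ , P′-nonsingular)
           , Equivalence.from (orbit⇔dihedral P P′ onD onD′) (linked⇒dihedral P P′ onD onD′ linked))
      where
      P′-nonsingular : ¬ Singular p t (φₚ P′)
      P′-nonsingular singular = P≢origin (linked-with-origin P (subst OnDₚ P′≡origin onD′) onD
                                            (subst (Linked P) P′≡origin linked))
        where
        P′≡origin : P′ ≡ origin
        P′≡origin = Equivalence.to (singular⇔origin P′ onD′) singular
    from : PairCondition (φₚ P) (φₚ P′) → Linked P P′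
    from (inj₁ (_ , _ , orbit)) = dihedral⇒linked P P′ (Equivalence.to (orbit⇔dihedral P P′ onD onD′) orbit)
    from (inj₂ (singular , singular′)) =
      inj₁ (cong (sq ∘ proj₁) (trans (Equivalence.to (singular⇔origin P onD) singular)
                                     (sym (Equivalence.to (singular⇔origin P′ onD′) singular′))))

-- Three points P₀, P₁, P₂ of D_t, playing the roles of (t₁₂, t₃₄), (t₁₃, t₂₄)
-- and (t₁₄, t₂₃).
module Quadruple (p : ℕ) .{{_ : NonZero p}} (p-prime : Prime p) (p≢2 : p ≢ 2) (t : F p) (t≢0 : t ≢ fromN p 0)
                 (P : Fin 3 → F p × F p) (onD : ∀ i → OnD p t (proj₁ (P i)) (proj₂ (P i))) where

  open CurveD p p-prime p≢2 t t≢0 public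

  x y u : Fin 3 → F p
  x i = proj₁ (P i)
  y i = proj₂ (P i)
  u i = sq (x i) ⊝ 1F

  q : Fin 4 → Alg p
  q = quadruple p (x f0) (x (fs f0)) (x (fs (fs f0))) (y (fs (fs f0)))

  z A : F p
  z = sq (y (fs (fs f0))) ⊝ 1F
  A = u f0 ⊛ u (fs f0) ⊛ invF p z

  u≢0 : ∀ i → u i ≢ 0F
  u≢0 i = x²-1≢0 (x i) (y i) (onD i)

  z≢0 : z ≢ 0F
  z≢0 = x²-1≢0 (y (fs (fs f0))) (x (fs (fs f0))) (OnD-swap (x (fs (fs f0))) (y (fs (fs f0))) (onD (fs (fs f0))))

  A≢0 : A ≢ 0F
  A≢0 = nonzero-product (nonzero-product (u≢0 f0) (u≢0 (fs f0))) (inverse≢0 z≢0)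

  -- (a, b, c, d) = a⁻¹ (A, u₀, u₁, u₂).
  s : Fin 4 → F p
  s f0 = A
  s (fs i) = u i

  other-entry : ∀ c → mulA p A (subA p A (scal p A (sq c)) (scal p A 1F)) (0F , invF p A)
                      ≡ (0F , (sq c ⊝ 1F) ⊛ invF p A)
  other-entry c = cong₂ _,_
    (solve 3 (λ c a b → (c :* c :- lit 1) :* lit 0 :+ a :* (lit 0 :- lit 0) :* b := lit 0) refl c A (invF p A))
    (solve 2 (λ c b → (c :* c :- lit 1) :* b :+ (lit 0 :- lit 0) :* lit 0 := (c :* c :- lit 1) :* b) refl c (invF p A))

  entries : ∀ i → q i ≡ (0F , s i ⊛ invF p A)
  entries f0 = cong (0F ,_) (sym (inverse A≢0))
  entries (fs f0) = other-entry (x f0)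
  entries (fs (fs f0)) = other-entry (x (fs f0))
  entries (fs (fs (fs f0))) = other-entry (x (fs (fs f0)))

  q-coincide⇔ : ∀ i j → q i ≡ q j ⇔ s i ≡ s j
  q-coincide⇔ i j = mk⇔
    (λ qi≡qj → *-cancelˡ (inverse≢0 A≢0) (begin
      invF p A ⊛ s i    ≡⟨ *-comm (invF p A) (s i) ⟩
      s i ⊛ invF p A    ≡⟨ cong proj₂ (trans (sym (entries i)) (trans qi≡qj (entries j))) ⟩
      s j ⊛ invF p A    ≡⟨ *-comm (s j) (invF p A) ⟩
      invF p A ⊛ s j    ∎))
    (λ si≡sj → trans (entries i) (trans (cong (λ c → 0F , c ⊛ invF p A) si≡sj) (sym (entries j))))
    where open ≡-Reasoning

  u≡u⇔ : ∀ i j → u i ≡ u j ⇔ sq (x i) ≡ sq (x j)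
  u≡u⇔ i j = shifted-squares⇔ (x i) (x j)

  A≡u₀⇔ : A ≡ u f0 ⇔ sq (x (fs f0)) ≡ sq (y (fs (fs f0)))
  A≡u₀⇔ = ⇔-trans (division z≢0) (⇔-trans (*-cancel⇔ (u≢0 f0)) (shifted-squares⇔ (x (fs f0)) (y (fs (fs f0)))))

  A≡u₁⇔ : A ≡ u (fs f0) ⇔ sq (x f0) ≡ sq (y (fs (fs f0)))
  A≡u₁⇔ = ⇔-trans (division z≢0)
            (⇔-trans (mk⇔ (trans (*-comm (u (fs f0)) (u f0))) (trans (*-comm (u f0) (u (fs f0)))))
              (⇔-trans (*-cancel⇔ (u≢0 (fs f0))) (shifted-squares⇔ (x f0) (y (fs (fs f0))))))

  -- Here u₂ z = t = u₀ (t₃₄² - 1).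
  A≡u₂⇔ : A ≡ u (fs (fs f0)) ⇔ sq (x (fs f0)) ≡ sq (y f0)
  A≡u₂⇔ = ⇔-trans (division z≢0)
            (⇔-trans (mk⇔ (λ e → trans e u₂z≡u₀u₀′) (λ e → trans e (sym u₂z≡u₀u₀′)))
              (⇔-trans (*-cancel⇔ (u≢0 f0)) (shifted-squares⇔ (x (fs f0)) (y f0))))
    where
    u₂z≡u₀u₀′ : u (fs (fs f0)) ⊛ z ≡ u f0 ⊛ (sq (y f0) ⊝ 1F)
    u₂z≡u₀u₀′ = trans (onD (fs (fs f0))) (sym (onD f0))

  cross-sym : ∀ i j → sq (x i) ≡ sq (y j) → sq (x j) ≡ sq (y i)
  cross-sym i j e = sym (other-coordinate (x i) (y i) (y j) (x j) (onD i) (OnD-swap (x j) (y j) (onD j)) e)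

  Coincidence : Set
  Coincidence = ∃[ i ] ∃[ j ] (i ≢ j × s i ≡ s j)

  LinkedPair : Set
  LinkedPair = ∃[ i ] ∃[ j ] (i ≢ j × Linked (P i) (P j))

  A-coincidence⇒linked : ∀ j → A ≡ u j → LinkedPair
  A-coincidence⇒linked f0 e = fs f0 , fs (fs f0) , (λ ()) , inj₂ (Equivalence.to A≡u₀⇔ e)
  A-coincidence⇒linked (fs f0) e = f0 , fs (fs f0) , (λ ()) , inj₂ (Equivalence.to A≡u₁⇔ e)
  A-coincidence⇒linked (fs (fs f0)) e = fs f0 , f0 , (λ ()) , inj₂ (Equivalence.to A≡u₂⇔ e)

  coincidence⇒linked : ∀ i j → i ≢ j → s i ≡ s j → LinkedPair
  coincidence⇒linked f0 (fs j) _ e = A-coincidence⇒linked j e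
  coincidence⇒linked (fs i) f0 _ e = A-coincidence⇒linked i (sym e)
  coincidence⇒linked (fs i) (fs j) i≢j e =
    i , j , (λ i≡j → i≢j (cong fs i≡j)) , inj₁ (Equivalence.to (u≡u⇔ i j) e)
  coincidence⇒linked f0 f0 i≢i _ = ⊥-elim (i≢i refl)

  linked⇒coincidence : ∀ i j → i ≢ j → Linked (P i) (P j) → Coincidence
  linked⇒coincidence i j i≢j (inj₁ e) =
    fs i , fs j , (λ i≡j → i≢j (Fin.suc-injective i≡j)) , Equivalence.from (u≡u⇔ i j) e
  linked⇒coincidence f0 (fs f0) _ (inj₂ e) =
    f0 , fs (fs (fs f0)) , (λ ()) , Equivalence.from A≡u₂⇔ (cross-sym f0 (fs f0) e)
  linked⇒coincidence (fs f0) f0 _ (inj₂ e) =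
    f0 , fs (fs (fs f0)) , (λ ()) , Equivalence.from A≡u₂⇔ e
  linked⇒coincidence f0 (fs (fs f0)) _ (inj₂ e) =
    f0 , fs (fs f0) , (λ ()) , Equivalence.from A≡u₁⇔ e
  linked⇒coincidence (fs (fs f0)) f0 _ (inj₂ e) =
    f0 , fs (fs f0) , (λ ()) , Equivalence.from A≡u₁⇔ (cross-sym (fs (fs f0)) f0 e)
  linked⇒coincidence (fs f0) (fs (fs f0)) _ (inj₂ e) =
    f0 , fs f0 , (λ ()) , Equivalence.from A≡u₀⇔ e
  linked⇒coincidence (fs (fs f0)) (fs f0) _ (inj₂ e) =
    f0 , fs f0 , (λ ()) , Equivalence.from A≡u₀⇔ (cross-sym (fs (fs f0)) (fs f0) e)
  linked⇒coincidence f0 f0 i≢i _ = ⊥-elim (i≢i refl)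
  linked⇒coincidence (fs f0) (fs f0) i≢i _ = ⊥-elim (i≢i refl)
  linked⇒coincidence (fs (fs f0)) (fs (fs f0)) i≢i _ = ⊥-elim (i≢i refl)

  repeated⇔linked : NotPairwiseDistinct p q ⇔ LinkedPair
  repeated⇔linked = mk⇔
    (λ (i , j , i≢j , qi≡qj) → coincidence⇒linked i j i≢j (Equivalence.to (q-coincide⇔ i j) qi≡qj))
    (λ (i , j , i≢j , linked) → let (k , l , k≢l , sk≡sl) = linked⇒coincidence i j i≢j linked
                                in k , l , k≢l , Equivalence.from (q-coincide⇔ k l) sk≡sl)

module _ {I : Set} {A B : I → I → Set} where

  distinct-pairs-cong : (∀ i j → A i j ⇔ B i j) →
                        (∃[ i ] ∃[ j ] (i ≢ j × A i j)) ⇔ (∃[ i ] ∃[ j ] (i ≢ j × B i j))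
  distinct-pairs-cong A⇔B = mk⇔
    (λ (i , j , i≢j , a) → i , j , i≢j , Equivalence.to (A⇔B i j) a)
    (λ (i , j , i≢j , b) → i , j , i≢j , Equivalence.from (A⇔B i j) b)

  distinct-pairs-distrib-⊎ : (∃[ i ] ∃[ j ] (i ≢ j × (A i j ⊎ B i j))) ⇔
                             ((∃[ i ] ∃[ j ] (i ≢ j × A i j)) ⊎ (∃[ i ] ∃[ j ] (i ≢ j × B i j)))
  distinct-pairs-distrib-⊎ = mk⇔
    (λ (i , j , i≢j , a⊎b) → Sum.map (λ a → i , j , i≢j , a) (λ b → i , j , i≢j , b) a⊎b)
    Sum.[ (λ (i , j , i≢j , a) → i , j , i≢j , inj₁ a) , (λ (i , j , i≢j , b) → i , j , i≢j , inj₂ b) ]′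

lemma2p1 : (p : ℕ) .{{_ : NonZero p}} → Prime p → p ≢ 2 →
    (t : F p) → t ≢ fromN p 0 →
    (Q : Fin 3 → Pt p) → (∀ i → InẼ p t (Q i)) →
    (P : Fin 3 → F p × F p) → (∀ i → OnD p t (proj₁ (P i)) (proj₂ (P i))) →
    (∀ i → φ p t (proj₁ (P i)) (proj₂ (P i)) ≡ Q i) →
    NotPairwiseDistinct p
      (quadruple p (proj₁ (P f0)) (proj₁ (P (fs f0))) (proj₁ (P (fs (fs f0)))) (proj₂ (P (fs (fs f0)))))
    ⇔
    ((∃[ i ] ∃[ j ] (i ≢ j × Nonsingular p t (Q i) × Nonsingular p t (Q j) ×
        Σ[ k ∈ Fin 4 ]
          (Q i ≡ addPt p t (Q j) (mulR p t (toℕ k))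
           ⊎ Q i ≡ addPt p t (negPt p (Q j)) (mulR p t (toℕ k)))))
     ⊎ (∃[ i ] ∃[ j ] (i ≢ j × Singular p t (Q i) × Singular p t (Q j))))
lemma2p1 p p-prime p≢2 t t≢0 Q _ P onD φP≡Q =
  ⇔-trans repeated⇔linked (⇔-trans (distinct-pairs-cong criterion) distinct-pairs-distrib-⊎)
  where
  open Quadruple p p-prime p≢2 t t≢0 P onD
  criterion : ∀ i j → Linked (P i) (P j) ⇔ PairCondition (Q i) (Q j)
  criterion i j = subst₂ (λ Q Q′ → Linked (P i) (P j) ⇔ PairCondition Q Q′) (φP≡Q i) (φP≡Q j)
                         (linked⇔pair-condition (P i) (P j) (onD i) (onD j))
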